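{- Let $M$ be an $m \times n$ matrix over $\{ -1,0,1\}$. The directed split graph $G_o(M)$ is semi-transitive if $M$ satisfies: (i) every row of $M$ is of the form $0^r1^s0^t$ or $0^r(-1)^s0^t$ or $1^r0^s(-1)^t$ for some $r,s,t\ge0$; and (ii) for each row of $M$ of the form $1^a0^b(-1)^c$ with $a,c>0$ and $b\ge0$, there is no row of $M$ distinct from $1^a0^b(-1)^c$ whose entries in positions $a$ and $a+b+1$ are both nonzero.
   Context: Rows of matrices are written as strings of length $n$; $x^r$ denotes the symbol $x$ repeated $r$ times. For an $m\times n$ matrix $M=[m_{ij}]$ over $\{ -1,0,1\}$, $G_o(M)$ is the directed graph on vertex set $\{1,\dots,n+m\}$ with edges $j\to i$ for all $1\le j<i\le n$, and for $1\le p\le m$, $1\le j\le n$: an edge $j\to n+p$ if $m_{pj}=1$, an edge $n+p\to j$ if $m_{pj}=-1$, no edge if $m_{pj}=0$; no edges among $n+1,\dots,n+m$. A directed graph is semi-transitive if it is acyclic and for every directed path $u_1\to\cdots\to u_t$, $t\ge2$, either there is no edge $u_1\to u_t$ or all edges $u_i\to u_j$ ($1\le i<j\le t$) exist. -}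

module Defs where

open import Data.Nat using (ℕ; zero; suc; _+_; _∸_; _<_; _≤_; _<ᵇ_)
open import Data.Bool using (if_then_else_)
open import Data.Fin using (Fin; toℕ; inject₁; fromℕ) renaming (_<_ to _<ᶠ_; zero to fzero; suc to fsuc)
open import Data.Sum using (_⊎_; inj₁; inj₂)
open import Data.Product using (_×_; ∃; Σ)
open import Data.Empty using (⊥)
open import Relation.Nullary using (¬_)
open import Relation.Binary.PropositionalEquality using (_≡_; _≢_)
open import Function.Definitions using (Injective)

data Entry : Set where
  neg zer pos : Entry

-- An m × n matrix over {-1,0,1}; M p j is the entry in row p, column j (0-indexed).
Matrix : ℕ → ℕ → Set
Matrix m n = Fin m → Fin n → Entry

-- Vertices of G_o(M): inj₁ j is column vertex j+1, inj₂ p is row vertex n+p+1.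
Vertex : ℕ → ℕ → Set
Vertex m n = Fin n ⊎ Fin m

Edge : ∀ {m n} → Matrix m n → Vertex m n → Vertex m n → Set
Edge M (inj₁ j) (inj₁ i) = j <ᶠ i
Edge M (inj₁ j) (inj₂ p) = M p j ≡ pos
Edge M (inj₂ p) (inj₁ j) = M p j ≡ neg
Edge M (inj₂ p) (inj₂ q) = ⊥

Acyclic : {V : Set} → (V → V → Set) → Set
Acyclic {V} E = ∀ k (u : Fin (suc (suc k)) → V) →
  (∀ (i : Fin (suc k)) → E (u (inject₁ i)) (u (fsuc i))) →
  u fzero ≡ u (fromℕ (suc k)) → ⊥

SemiTransitive : {V : Set} → (V → V → Set) → Set
SemiTransitive {V} E = Acyclic E ×
  (∀ k (u : Fin (suc (suc k)) → V) → Injective _≡_ _≡_ u →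
    (∀ (i : Fin (suc k)) → E (u (inject₁ i)) (u (fsuc i))) →
    E (u fzero) (u (fromℕ (suc k))) →
    ∀ (i j : Fin (suc (suc k))) → i <ᶠ j → E (u i) (u j))

-- The string x^r y^s z^t evaluated at 0-indexed position j
block : ℕ → ℕ → Entry → Entry → Entry → ℕ → Entry
block r s x y z j = if j <ᵇ r then x else (if j <ᵇ r + s then y else z)

RowForm : ∀ {m n} → Matrix m n → Fin m → Entry → Entry → Entry → Set
RowForm {n = n} M p x y z =
  ∃ λ r → ∃ λ s → ∃ λ t → (r + s + t ≡ n) × (∀ j → M p j ≡ block r s x y z (toℕ j))

CondI : ∀ {m n} → Matrix m n → Set
CondI M = ∀ p → RowForm M p zer pos zer ⊎ RowForm M p zer neg zer ⊎ RowForm M p pos zer neg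

-- Condition (ii): if row p is 1^a 0^b (-1)^c with a, c > 0, then no row q whose
-- content differs from row p has nonzero entries at (1-indexed) positions a and a+b+1,
-- i.e. 0-indexed positions a-1 and a+b.
CondII : ∀ {m n} → Matrix m n → Set
CondII {n = n} M = ∀ p a b c → a + b + c ≡ n → 0 < a → 0 < c →
  (∀ j → M p j ≡ block a b pos zer neg (toℕ j)) →
  ∀ q → ¬ (∀ j → M q j ≡ M p j) →
  ∀ (j k : Fin n) → toℕ j ≡ a ∸ 1 → toℕ k ≡ a + b →
  ¬ (M q j ≢ zer × M q k ≢ zer)

-- Give column j height 2j+1, a row 1^a 0^b (-1)^c height 2a, rows 0^r 1^s 0^t the top
-- height and rows 0^r (-1)^s 0^t height 0: every edge goes up, so G_o(M) is acyclic and
-- the columns met along a walk increase. On a walk u_0 → ⋯ → u_K with shortcut u_0 → u_K,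
-- a row vertex is entered from a column where it is 1 and left to a column where it is -1
-- (at the ends of the walk the shortcut supplies the missing one), so by convexity of the
-- nonzero blocks of a row all column–row and row–column edges are present. Two row
-- vertices on the walk would put between them a column that is -1 in the first row and 1
-- in the second; then one of the two rows has both signs and the other is nonzero at both
-- ends of its zero gap, which (ii) forbids.
module Submission where

open import Defs
open import Data.Nat using (ℕ; zero; suc; _+_; _*_; _∸_; _<_; _≤_; _<ᵇ_; z≤n; s≤s; z<s; s≤s⁻¹; s<s⁻¹)
open import Data.Nat.Properties
open import Data.Bool using (true; false)
open import Data.Fin using (Fin; toℕ; inject₁; fromℕ; fromℕ<) renaming (zero to fzero; suc to fsuc)
open import Data.Fin.Properties using (toℕ<n; toℕ-fromℕ<)
open import Data.Sum using (_⊎_; inj₁; inj₂)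
open import Data.Product using (_×_; _,_; ∃)
open import Data.Empty using (⊥; ⊥-elim)
open import Function using (_∘_; case_of_)
open import Relation.Nullary using (yes; no)
open import Relation.Binary.PropositionalEquality

Walk : {V : Set} → (V → V → Set) → ℕ → (ℕ → V) → Set
Walk E K U = ∀ l → l < K → E (U l) (U (suc l))

module _ {V : Set} (E : V → V → Set) (φ : V → ℕ) (φ-< : ∀ {u v} → E u v → φ u < φ v) where

  walk-potential-< : ∀ {K U} → Walk E K U → ∀ {i j} → i < j → j ≤ K → φ (U i) < φ (U j)
  walk-potential-< walk {i} {suc j} i<1+j 1+j≤K with m≤n⇒m<n∨m≡n (s≤s⁻¹ i<1+j)
  ... | inj₁ i<j  = <-trans (walk-potential-< walk i<j (≤-trans (n≤1+n j) 1+j≤K)) (φ-< (walk j 1+j≤K))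
  ... | inj₂ refl = φ-< (walk j 1+j≤K)

  walk-potential-≤ : ∀ {K U} → Walk E K U → ∀ {i j} → i ≤ j → j ≤ K → φ (U i) ≤ φ (U j)
  walk-potential-≤ walk i≤j j≤K with m≤n⇒m<n∨m≡n i≤j
  ... | inj₁ i<j  = <⇒≤ (walk-potential-< walk i<j j≤K)
  ... | inj₂ refl = ≤-refl

-- Indices beyond k are sent to k, so a walk indexed by Fin (suc k) can be read as one indexed by ℕ.
clamp : ∀ k → ℕ → Fin (suc k)
clamp k       zero    = fzero
clamp zero    (suc l) = fzero
clamp (suc k) (suc l) = fsuc (clamp k l)

clamp-toℕ : ∀ {k} (i : Fin (suc k)) → clamp k (toℕ i) ≡ i
clamp-toℕ         fzero    = refl
clamp-toℕ {suc k} (fsuc i) = cong fsuc (clamp-toℕ i)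

clamp-inject₁ : ∀ {k l} → l ≤ k → clamp (suc k) l ≡ inject₁ (clamp k l)
clamp-inject₁ {l = zero}      _         = refl
clamp-inject₁ {suc k} {suc l} (s≤s l≤k) = cong fsuc (clamp-inject₁ l≤k)

clamp-last : ∀ k → clamp k k ≡ fromℕ k
clamp-last zero    = refl
clamp-last (suc k) = cong fsuc (clamp-last k)

module _ {V : Set} (E : V → V → Set) where

  clamp-walk : ∀ {k} (u : Fin (suc (suc k)) → V) →
    (∀ (i : Fin (suc k)) → E (u (inject₁ i)) (u (fsuc i))) → Walk E (suc k) (u ∘ clamp (suc k))
  clamp-walk {k} u steps l l<1+k =
    subst (λ i → E (u i) (u (fsuc (clamp k l)))) (sym (clamp-inject₁ (s≤s⁻¹ l<1+k))) (steps (clamp k l))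

  acyclic-by-potential : (φ : V → ℕ) → (∀ {u v} → E u v → φ u < φ v) → Acyclic E
  acyclic-by-potential φ φ-< k u steps closed =
    <-irrefl (cong φ (trans closed (cong u (sym (clamp-last (suc k))))))
             (walk-potential-< E φ φ-< (clamp-walk u steps) z<s ≤-refl)

  semiTransitive-by-walks : Acyclic E →
    (∀ K U → Walk E K U → E (U 0) (U K) → ∀ {i j} → i < j → j ≤ K → E (U i) (U j)) →
    SemiTransitive E
  semiTransitive-by-walks acyclic shortcut = acyclic , λ k u _ steps top i j i<j →
    subst₂ E (cong u (clamp-toℕ i)) (cong u (clamp-toℕ j))
      (shortcut (suc k) (u ∘ clamp (suc k)) (clamp-walk u steps)
                (subst (E (u fzero) ∘ u) (sym (clamp-last (suc k))) top)
                i<j (s≤s⁻¹ (toℕ<n j)))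

data Segment (r s j : ℕ) : Set where
  first  : j < r → Segment r s j
  second : r ≤ j → j < r + s → Segment r s j
  third  : r + s ≤ j → Segment r s j

segment : ∀ r s j → Segment r s j
segment r s j with j <? r | j <? r + s
... | yes j<r | _          = first j<r
... | no j≮r  | yes j<r+s  = second (≮⇒≥ j≮r) j<r+s
... | no _    | no j≮r+s   = third (≮⇒≥ j≮r+s)

module _ (r s : ℕ) {x y z : Entry} where

  block-first : ∀ {j} → j < r → block r s x y z j ≡ x
  block-first {j} j<r with j <ᵇ r | <⇒<ᵇ j<r
  ... | true | _ = refl

  block-second : ∀ {j} → r ≤ j → j < r + s → block r s x y z j ≡ y
  block-second {j} r≤j j<r+s with j <ᵇ r | <ᵇ⇒< j r | j <ᵇ r + s | <⇒<ᵇ j<r+s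
  ... | true  | j<r | _    | _ = ⊥-elim (<⇒≱ (j<r _) r≤j)
  ... | false | _   | true | _ = refl

  block-third : ∀ {j} → r + s ≤ j → block r s x y z j ≡ z
  block-third {j} r+s≤j with j <ᵇ r | <ᵇ⇒< j r | j <ᵇ r + s | <ᵇ⇒< j (r + s)
  ... | true  | j<r | _     | _     = ⊥-elim (<⇒≱ (j<r _) (≤-trans (m≤m+n r s) r+s≤j))
  ... | false | _   | true  | j<r+s = ⊥-elim (<⇒≱ (j<r+s _) r+s≤j)
  ... | false | _   | false | _     = refl

  block-first-only : ∀ {j w} → y ≢ w → z ≢ w → block r s x y z j ≡ w → j < r
  block-first-only {j} y≢w z≢w eq with segment r s j
  ... | first j<r        = j<r
  ... | second r≤j j<r+s = ⊥-elim (y≢w (trans (sym (block-second r≤j j<r+s)) eq))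
  ... | third r+s≤j      = ⊥-elim (z≢w (trans (sym (block-third r+s≤j)) eq))

  block-third-only : ∀ {j w} → x ≢ w → y ≢ w → block r s x y z j ≡ w → r + s ≤ j
  block-third-only {j} x≢w y≢w eq with segment r s j
  ... | first j<r        = ⊥-elim (x≢w (trans (sym (block-first j<r)) eq))
  ... | second r≤j j<r+s = ⊥-elim (y≢w (trans (sym (block-second r≤j j<r+s)) eq))
  ... | third r+s≤j      = r+s≤j

  block-avoids : ∀ {j w} → x ≢ w → y ≢ w → z ≢ w → block r s x y z j ≢ w
  block-avoids x≢w y≢w z≢w eq = z≢w (trans (sym (block-third (block-third-only x≢w y≢w eq))) eq)

  block-convex : ∀ {i j k w} → x ≢ w ⊎ z ≢ w →
    block r s x y z i ≡ w → block r s x y z k ≡ w → i ≤ j → j ≤ k → block r s x y z j ≡ w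
  block-convex {i} {j} {k} ends eqi eqk i≤j j≤k with segment r s j
  ... | first j<r   = trans (block-first j<r) (trans (sym (block-first (≤-<-trans i≤j j<r))) eqi)
  ... | third r+s≤j = trans (block-third r+s≤j) (trans (sym (block-third (≤-trans r+s≤j j≤k))) eqk)
  ... | second r≤j j<r+s with segment r s i | segment r s k
  ...   | second r≤i i<r+s | _ = trans (block-second r≤j j<r+s) (trans (sym (block-second r≤i i<r+s)) eqi)
  ...   | _ | second r≤k k<r+s = trans (block-second r≤j j<r+s) (trans (sym (block-second r≤k k<r+s)) eqk)
  ...   | third r+s≤i | _      = ⊥-elim (<⇒≱ j<r+s (≤-trans r+s≤i i≤j))
  ...   | _ | first k<r        = ⊥-elim (<⇒≱ k<r (≤-trans r≤j j≤k))
  ...   | first i<r | third r+s≤k with ends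
  ...     | inj₁ x≢w = ⊥-elim (x≢w (trans (sym (block-first i<r)) eqi))
  ...     | inj₂ z≢w = ⊥-elim (z≢w (trans (sym (block-third r+s≤k)) eqk))

opposite-signs : ∀ {e f : Entry} → e ≡ pos → f ≡ neg → e ≢ f
opposite-signs refl refl ()

nonzero-sign : ∀ {w} → w ≢ zer → pos ≢ w ⊎ neg ≢ w
nonzero-sign {neg} _   = inj₁ (λ ())
nonzero-sign {zer} w≢0 = ⊥-elim (w≢0 refl)
nonzero-sign {pos} _   = inj₂ (λ ())

positive-gap : ∀ {l r j} → l ≤ j → j < l + r → 0 < r
positive-gap {l} {zero}  l≤j j<l+0 = ⊥-elim (<⇒≱ j<l+0 (subst (_≤ _) (sym (+-identityʳ l)) l≤j))
positive-gap {r = suc r} _   _     = z<s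

module _ {m n : ℕ} {M : Matrix m n} where

  rowForm-convex : ∀ {p x y z w} {i j k : Fin n} → RowForm M p x y z → x ≢ w ⊎ z ≢ w →
    M p i ≡ w → M p k ≡ w → toℕ i ≤ toℕ j → toℕ j ≤ toℕ k → M p j ≡ w
  rowForm-convex {i = i} {j} {k} (r , s , _ , _ , row) ends pi pk i≤j j≤k =
    trans (row j) (block-convex r s ends (trans (sym (row i)) pi) (trans (sym (row k)) pk) i≤j j≤k)

  record MixedRow (p : Fin m) : Set where
    field
      a b c   : ℕ
      a+b+c≡n : a + b + c ≡ n
      0<a     : 0 < a
      0<c     : 0 < c
      row     : ∀ j → M p j ≡ block a b pos zer neg (toℕ j)

    pos⇒before-gap : ∀ {j} → M p j ≡ pos → toℕ j < a
    pos⇒before-gap {j} pj = block-first-only a b (λ ()) (λ ()) (trans (sym (row j)) pj)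

    neg⇒after-gap : ∀ {j} → M p j ≡ neg → a + b ≤ toℕ j
    neg⇒after-gap {j} pj = block-third-only a b (λ ()) (λ ()) (trans (sym (row j)) pj)

    before-gap⇒pos : ∀ {j} → toℕ j < a → M p j ≡ pos
    before-gap⇒pos {j} j<a = trans (row j) (block-first a b j<a)

    after-gap⇒neg : ∀ {j} → a + b ≤ toℕ j → M p j ≡ neg
    after-gap⇒neg {j} a+b≤j = trans (row j) (block-third a b a+b≤j)

  edge-into-row : ∀ {v q} → Edge M v (inj₂ q) → ∃ λ c → v ≡ inj₁ c × M q c ≡ pos
  edge-into-row {inj₁ c} qc = c , refl , qc

  edge-out-of-row : ∀ {v q} → Edge M (inj₂ q) v → ∃ λ d → v ≡ inj₁ d × M q d ≡ neg
  edge-out-of-row {inj₁ d} qd = d , refl , qd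

  module _ (condI : CondI M) where

    nonzero-convex : ∀ p {w} {i j k : Fin n} → w ≢ zer →
      M p i ≡ w → M p k ≡ w → toℕ i ≤ toℕ j → toℕ j ≤ toℕ k → M p j ≡ w
    nonzero-convex p w≢0 with condI p
    ... | inj₁ zpz        = rowForm-convex zpz (inj₁ (≢-sym w≢0))
    ... | inj₂ (inj₁ znz) = rowForm-convex znz (inj₁ (≢-sym w≢0))
    ... | inj₂ (inj₂ pzn) = rowForm-convex pzn (nonzero-sign w≢0)

    mixed : ∀ {p} {x y : Fin n} → M p x ≡ pos → M p y ≡ neg → MixedRow p
    mixed {p} {x} {y} px ny with condI p
    ... | inj₁ (r , s , _ , _ , row) =
      ⊥-elim (block-avoids r s (λ ()) (λ ()) (λ ()) (trans (sym (row y)) ny))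
    ... | inj₂ (inj₁ (r , s , _ , _ , row)) =
      ⊥-elim (block-avoids r s (λ ()) (λ ()) (λ ()) (trans (sym (row x)) px))
    ... | inj₂ (inj₂ (a , b , c , a+b+c≡n , row)) = record
      { a = a ; b = b ; c = c ; a+b+c≡n = a+b+c≡n ; row = row
      ; 0<a = ≤-<-trans z≤n (block-first-only a b (λ ()) (λ ()) (trans (sym (row x)) px))
      ; 0<c = positive-gap (block-third-only a b (λ ()) (λ ()) (trans (sym (row y)) ny))
                           (subst (toℕ y <_) (sym a+b+c≡n) (toℕ<n y))
      }

    pos-downward-closed : ∀ {p} {c c' d : Fin n} →
      M p c' ≡ pos → M p d ≡ neg → toℕ c ≤ toℕ c' → M p c ≡ pos
    pos-downward-closed pc' pd c≤c' = before-gap⇒pos (≤-<-trans c≤c' (pos⇒before-gap pc'))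
      where open MixedRow (mixed pc' pd)

    neg-upward-closed : ∀ {p} {c d d' : Fin n} →
      M p c ≡ pos → M p d' ≡ neg → toℕ d' ≤ toℕ d → M p d ≡ neg
    neg-upward-closed pc pd' d'≤d = after-gap⇒neg (≤-trans (neg⇒after-gap pd') d'≤d)
      where open MixedRow (mixed pc pd')

    gap-not-spanned : CondII M → ∀ {p q w} {x y k : Fin n} → M p x ≡ pos → M p y ≡ neg →
      w ≢ zer → M q x ≡ w → M q y ≡ w → M q k ≢ M p k → ⊥
    gap-not-spanned condII {p} {q} {x = x} {y} {k} px ny w≢0 qx qy differ =
      condII p a b c a+b+c≡n 0<a 0<c row q (λ same → differ (same k))
             (fromℕ< a∸1<n) (fromℕ< a+b<n) (toℕ-fromℕ< a∸1<n) (toℕ-fromℕ< a+b<n)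
             (nonzero-at a∸1<n (<⇒≤pred x<a) (≤-trans (m∸n≤m a 1) a≤y) ,
              nonzero-at a+b<n (≤-trans (<⇒≤ x<a) (m≤m+n a b)) a+b≤y)
      where
      open MixedRow (mixed px ny)
      x<a : toℕ x < a
      x<a = pos⇒before-gap px
      a+b≤y : a + b ≤ toℕ y
      a+b≤y = neg⇒after-gap ny
      a≤y : a ≤ toℕ y
      a≤y = ≤-trans (m≤m+n a b) a+b≤y
      a+b<n : a + b < n
      a+b<n = ≤-<-trans a+b≤y (toℕ<n y)
      a∸1<n : a ∸ 1 < n
      a∸1<n = ≤-<-trans (m∸n≤m a 1) (≤-<-trans a≤y (toℕ<n y))
      nonzero-at : ∀ {v} (v<n : v < n) → toℕ x ≤ v → v ≤ toℕ y → M q (fromℕ< v<n) ≢ zer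
      nonzero-at v<n x≤v v≤y = w≢0 ∘ trans (sym (nonzero-convex q w≢0 qx qy
        (subst (toℕ x ≤_) (sym (toℕ-fromℕ< v<n)) x≤v) (subst (_≤ toℕ y) (sym (toℕ-fromℕ< v<n)) v≤y)))

    height : Vertex m n → ℕ
    height (inj₁ j) = suc (2 * toℕ j)
    height (inj₂ p) = row-height (condI p)
      where
      row-height : RowForm M p zer pos zer ⊎ RowForm M p zer neg zer ⊎ RowForm M p pos zer neg → ℕ
      row-height (inj₁ _)              = suc (2 * n)
      row-height (inj₂ (inj₁ _))       = 0
      row-height (inj₂ (inj₂ (a , _))) = 2 * a

    height-< : ∀ {u v} → Edge M u v → height u < height v
    height-< {inj₁ i} {inj₁ j} i<j = s≤s (*-monoʳ-< 2 i<j)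
    height-< {inj₁ j} {inj₂ p} pj with condI p
    ... | inj₁ _ = s≤s (*-monoʳ-< 2 (toℕ<n j))
    ... | inj₂ (inj₁ (r , s , _ , _ , row)) =
      ⊥-elim (block-avoids r s (λ ()) (λ ()) (λ ()) (trans (sym (row j)) pj))
    ... | inj₂ (inj₂ (a , b , _ , _ , row)) =
      subst (_≤ 2 * a) (*-suc 2 (toℕ j))
        (*-monoʳ-≤ 2 (block-first-only a b (λ ()) (λ ()) (trans (sym (row j)) pj)))
    height-< {inj₂ p} {inj₁ j} pj with condI p
    ... | inj₁ (r , s , _ , _ , row) =
      ⊥-elim (block-avoids r s (λ ()) (λ ()) (λ ()) (trans (sym (row j)) pj))
    ... | inj₂ (inj₁ _) = z<s
    ... | inj₂ (inj₂ (a , b , _ , _ , row)) =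
      s≤s (*-monoʳ-≤ 2 (≤-trans (m≤m+n a b)
                                (block-third-only a b (λ ()) (λ ()) (trans (sym (row j)) pj))))

    module ShortcutWalk {K : ℕ} {U : ℕ → Vertex m n}
                        (walk : Walk (Edge M) K U) (shortcut : Edge M (U 0) (U K)) where

      column-< : ∀ {i j c d} → U i ≡ inj₁ c → U j ≡ inj₁ d → i < j → j ≤ K → toℕ c < toℕ d
      column-< ui uj i<j j≤K = *-cancelˡ-< 2 _ _ (s<s⁻¹
        (subst₂ _<_ (cong height ui) (cong height uj) (walk-potential-< (Edge M) height height-< walk i<j j≤K)))

      column-≤ : ∀ {i j c d} → U i ≡ inj₁ c → U j ≡ inj₁ d → i ≤ j → j ≤ K → toℕ c ≤ toℕ d
      column-≤ ui uj i≤j j≤K = *-cancelˡ-≤ 2 (s≤s⁻¹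
        (subst₂ _≤_ (cong height ui) (cong height uj) (walk-potential-≤ (Edge M) height height-< walk i≤j j≤K)))

      column-before : ∀ {j q} → U (suc j) ≡ inj₂ q → suc j ≤ K → ∃ λ c → U j ≡ inj₁ c × M q c ≡ pos
      column-before {j} uj j<K = edge-into-row (subst (Edge M (U j)) uj (walk j j<K))

      column-after : ∀ {i q} → U i ≡ inj₂ q → i < K → ∃ λ d → U (suc i) ≡ inj₁ d × M q d ≡ neg
      column-after {i} ui i<K = edge-out-of-row (subst (λ v → Edge M v (U (suc i))) ui (walk i i<K))

      column-first : ∀ {q} → U K ≡ inj₂ q → ∃ λ c → U 0 ≡ inj₁ c × M q c ≡ pos
      column-first uK = edge-into-row (subst (Edge M (U 0)) uK shortcut)

      column-last : ∀ {q} → U 0 ≡ inj₂ q → ∃ λ d → U K ≡ inj₁ d × M q d ≡ neg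
      column-last u0 = edge-out-of-row (subst (λ v → Edge M v (U K)) u0 shortcut)

      column-row : ∀ {i j c q} → U i ≡ inj₁ c → U j ≡ inj₂ q → i < j → j ≤ K → M q c ≡ pos
      column-row {j = suc j} {q = q} ui uj i<1+j 1+j≤K with m≤n⇒m<n∨m≡n 1+j≤K
      ... | inj₁ 1+j<K =
        let _ , uj' , qc' = column-before uj 1+j≤K
            _ , _   , qd  = column-after uj 1+j<K
        in pos-downward-closed qc' qd (column-≤ ui uj' (s≤s⁻¹ i<1+j) (≤-trans (n≤1+n j) 1+j≤K))
      ... | inj₂ 1+j≡K =
        let _ , uj' , qc' = column-before uj 1+j≤K
            _ , u0  , qc₀ = column-first (subst (λ l → U l ≡ inj₂ q) 1+j≡K uj)
        in nonzero-convex q (λ ()) qc₀ qc' (column-≤ u0 ui z≤n (≤-trans (<⇒≤ i<1+j) 1+j≤K))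
                                          (column-≤ ui uj' (s≤s⁻¹ i<1+j) (≤-trans (n≤1+n j) 1+j≤K))

      row-column : ∀ {i j q d} → U i ≡ inj₂ q → U j ≡ inj₁ d → i < j → j ≤ K → M q d ≡ neg
      row-column {zero} {q = q} u0 uj 0<j j≤K =
        let _ , u1 , qd₁ = column-after u0 (<-≤-trans 0<j j≤K)
            _ , uK , qdₖ = column-last u0
        in nonzero-convex q (λ ()) qd₁ qdₖ (column-≤ u1 uj 0<j j≤K) (column-≤ uj uK j≤K ≤-refl)
      row-column {suc i} ui uj i<j j≤K =
        let _ , _   , qc  = column-before ui (≤-trans (<⇒≤ i<j) j≤K)
            _ , ui' , qd' = column-after ui (<-≤-trans i<j j≤K)
        in neg-upward-closed qc qd' (column-≤ ui' uj i<j j≤K)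

      column-between : ∀ {i j q q'} → U i ≡ inj₂ q → U j ≡ inj₂ q' → i < j → j ≤ K →
        ∃ λ d → U (suc i) ≡ inj₁ d × suc i < j
      column-between ui uj i<j j≤K with column-after ui (<-≤-trans i<j j≤K) | m≤n⇒m<n∨m≡n i<j
      ... | d , ui' , _ | inj₁ 1+i<j = d , ui' , 1+i<j
      ... | _ , ui' , _ | inj₂ refl  = case trans (sym ui') uj of λ ()

      module _ (condII : CondII M) where

        row-row : ∀ {i j q q'} → U i ≡ inj₂ q → U j ≡ inj₂ q' → i < j → j ≤ K → ⊥
        row-row {zero} u0 uj 0<j j≤K with m≤n⇒m<n∨m≡n j≤K
        ... | inj₂ refl = subst₂ (Edge M) u0 uj shortcut
        ... | inj₁ j<K =
          let _ , u1 , 1<j = column-between u0 uj 0<j j≤K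
              _ , ug , q'g = column-after uj j<K
              q'd = column-row u1 uj 1<j j≤K
              qd  = row-column u0 u1 z<s (≤-trans (<⇒≤ 1<j) j≤K)
          in gap-not-spanned condII q'd q'g (λ ()) qd (row-column u0 ug z<s j<K)
                             (≢-sym (opposite-signs q'd qd))
        row-row {suc i} ui uj i<j j≤K =
          let _ , ud , 2+i<j = column-between ui uj i<j j≤K
              _ , uc , qc    = column-before ui (≤-trans (<⇒≤ i<j) j≤K)
              q'd = column-row ud uj 2+i<j j≤K
              qd  = row-column ui ud ≤-refl (≤-trans (<⇒≤ 2+i<j) j≤K)
          in gap-not-spanned condII qc qd (λ ()) (column-row uc uj (<-trans (n<1+n i) i<j) j≤K) q'd
                             (opposite-signs q'd qd)

        forward-edge : ∀ {i j} → i < j → j ≤ K → Edge M (U i) (U j)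
        forward-edge {i} {j} i<j j≤K with U i in ui | U j in uj
        ... | inj₁ _ | inj₁ _ = column-< ui uj i<j j≤K
        ... | inj₁ _ | inj₂ _ = column-row ui uj i<j j≤K
        ... | inj₂ _ | inj₁ _ = row-column ui uj i<j j≤K
        ... | inj₂ _ | inj₂ _ = row-row ui uj i<j j≤K

corollary2p13 : ∀ (m n : ℕ) (M : Matrix m n) → CondI M → CondII M → SemiTransitive (Edge M)
corollary2p13 m n M condI condII =
  semiTransitive-by-walks (Edge M) (acyclic-by-potential (Edge M) (height condI) (height-< condI))
    (λ K U walk shortcut → ShortcutWalk.forward-edge condI {K} {U} walk shortcut condII)
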